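{- There exists a countable collection $\mathcal{X}$ of infinite subsets of $\mathbb{N}$ such that the following holds. For every algorithm that generates in the limit (for every target $K\in\mathcal{X}$ and every enumeration of $K$), there exist a target language $K\in\mathcal{X}$ and an enumeration of $K$ by the adversary such that the set $O$ of strings generated by the algorithm satisfies $\delta_B(O,K)=0$.
   Context: Language generation in the limit: a countable collection $\mathcal{X}=\{L_1,L_2,\dots\}$ of languages (infinite subsets of $\mathbb{N}$) is fixed. An adversary picks a target $K\in\mathcal{X}$ and enumerates it: at each time step $t=1,2,\dots$ it reveals a string $w_t\in K$, such that every element of $K$ is eventually revealed. At time $t$ the algorithm, having seen $S_t=\{w_1,\dots,w_t\}$, outputs a string $o_t$. The algorithm generates in the limit if there is $t^*$ with $o_t\in K\setminus S_t$ for all $t\ge t^*$. The output set is $O=\{o_t: t\ge 1\}$. For infinite $B=\{b_1<b_2<\cdots\}\subseteq\mathbb{N}$ and $A\subseteq\mathbb{N}$, the lower Banach density of $A$ in $B$ is $\delta_B(A,B)=\liminf_{k\to\infty}\inf_{m\ge1}\frac{|\{i: m\le i\le m+k-1,\ b_i\in A\}|}{k}$. -}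

module Defs where

open import Data.Nat using (ℕ; zero; suc; _+_; _*_; _≤_; _<_)
open import Data.List using (List; map; upTo)
open import Data.Product using (Σ; ∃; _×_; _,_)
open import Relation.Nullary using (¬_)
open import Relation.Binary.PropositionalEquality using (_≡_)

Lang : Set₁
Lang = ℕ → Set

Infinite : Lang → Set
Infinite L = ∀ n → ∃ λ m → n ≤ m × L m

-- A collection is countable: indexed by ℕ (repetitions allowed).
Collection : Set₁
Collection = ℕ → Lang

IsEnumeration : Lang → (ℕ → ℕ) → Set
IsEnumeration K w = (∀ t → K (w t)) × (∀ x → K x → ∃ λ t → w t ≡ x)

-- An algorithm maps the finite sequence seen so far (w_0 … w_t) to an output.
Algorithm : Set
Algorithm = List ℕ → ℕ

prefix : (ℕ → ℕ) → ℕ → List ℕ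
prefix w n = map w (upTo n)

output : Algorithm → (ℕ → ℕ) → ℕ → ℕ
output A w t = A (prefix w (suc t))

InSeen : (ℕ → ℕ) → ℕ → ℕ → Set
InSeen w t x = ∃ λ s → s ≤ t × w s ≡ x

GeneratesFor : Algorithm → Lang → (ℕ → ℕ) → Set
GeneratesFor A K w =
  ∃ λ t* → ∀ t → t* ≤ t → K (output A w t) × ¬ InSeen w t (output A w t)

GeneratesInLimit : Collection → Algorithm → Set
GeneratesInLimit X A = ∀ i w → IsEnumeration (X i) w → GeneratesFor A (X i) w

InOutput : Algorithm → (ℕ → ℕ) → ℕ → Set
InOutput A w x = ∃ λ t → output A w t ≡ x

data Count (P : ℕ → Set) : ℕ → ℕ → ℕ → Set where
  cnt-nil  : ∀ {m} → Count P m zero zero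
  cnt-yes  : ∀ {m k c} → P m → Count P (suc m) k c → Count P m (suc k) (suc c)
  cnt-no   : ∀ {m k c} → ¬ P m → Count P (suc m) k c → Count P m (suc k) c

IsIncreasingEnum : Lang → (ℕ → ℕ) → Set
IsIncreasingEnum B b =
  (∀ i → b i < b (suc i)) × (∀ i → B (b i)) × (∀ x → B x → ∃ λ i → b i ≡ x)

-- liminf_{k} inf_m |{i ∈ [m, m+k-1] : b_i ∈ A}| / k = 0, i.e.
-- for every ε = 1/(j+1) and every N there are k ≥ N and m with
-- (count in window) < k/(j+1).
DensityZeroAlong : (ℕ → Set) → (ℕ → ℕ) → Set
DensityZeroAlong A b =
  ∀ j N → ∃ λ k → N ≤ k × ∃ λ m → ∃ λ c →
    Count (λ i → A (b i)) m k c × c * suc j < k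

LowerBanachDensityZero : (ℕ → Set) → Lang → Set
LowerBanachDensityZero A B = ∃ λ b → IsIncreasingEnum B b × DensityZeroAlong A b

{-# OPTIONS --safe #-}
-- ℕ is cut into consecutive windows [tri m, tri m + m], and the level of x is its offset in its window.
-- The collection consists of ℕ and of the languages Q ∪ {x | level x ≤ j} for finite Q.
--
-- Fix A. A level-j trap after a prefix Q is a continuation lead ++ [tri m, …, tri m + j] along which the
-- guesses of A stay below window m until the window starts, and afterwards, except possibly the last one,
-- never hit an element of window m that is still hidden. Level-0 traps exist because the guesses along Q
-- are bounded. Given level-j traps, enumerate Q ∪ {level ≤ j} by interleaving it with level-j traps; once
-- A generates correctly, its guess at the end of the next trap is an unseen element of Q ∪ {level ≤ j},
-- hence not higher up in window m, so the enumeration up to there is a level-(j + 1) trap after Q.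
-- Finally enumerate ℕ with a level-n trap at stage n: past the convergence time A no longer guesses
-- revealed strings, so it never outputs any of tri m, …, tri m + n, and O misses arbitrarily long
-- intervals of ℕ.
module Submission where

open import Defs
open import Data.Product using (∃; _×_; _,_; proj₁; proj₂)
open import Data.Nat using (ℕ; zero; suc; _+_; _∸_; _≤_; _<_; _≤′_; ≤′-refl; ≤′-step; z≤n; s≤s; _≟_; _≤?_; _<?_)
open import Data.Nat.Properties
open import Data.List using (List; []; _∷_; _++_; _∷ʳ_; length; take; map; upTo; applyUpTo; filter)
open import Data.List.Properties
  using (++-assoc; ++-identityʳ; length-++; length-applyUpTo; applyUpTo-∷ʳ; map-upTo; take-all)
open import Data.List.Membership.Propositional using (_∈_)
open import Data.List.Membership.Propositional.Properties
  using (∈-++⁺ˡ; ∈-++⁺ʳ; ∈-++⁻; ∈-applyUpTo⁺; ∈-applyUpTo⁻; ∈-filter⁺)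
open import Data.List.Relation.Unary.Any using (here; there)
open import Data.List.Relation.Unary.All as All using (All; [])
open import Data.List.Relation.Unary.All.Properties using (++⁺; applyUpTo⁺₁; all-filter)
open import Data.Sum using (_⊎_; inj₁; inj₂; [_,_]′)
open import Data.Unit using (⊤; tt)
open import Relation.Nullary using (¬_; yes; no; contradiction)
open import Relation.Binary.PropositionalEquality
open ≡-Reasoning

module _ {A : Set} where

  length-≤-++ˡ : ∀ (xs : List A) {ys} → length xs ≤ length (xs ++ ys)
  length-≤-++ˡ xs = subst (_ ≤_) (sym (length-++ xs)) (m≤m+n _ _)

  length-≤-++ʳ : ∀ (xs : List A) {ys} → length ys ≤ length (xs ++ ys)
  length-≤-++ʳ xs = subst (_ ≤_) (sym (length-++ xs)) (m≤n+m _ _)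

  take-++ˡ : ∀ (xs : List A) {ys n} → n ≤ length xs → take n (xs ++ ys) ≡ take n xs
  take-++ˡ xs       {n = zero}  _         = refl
  take-++ˡ (x ∷ xs) {n = suc n} (s≤s n≤) = cong (x ∷_) (take-++ˡ xs n≤)

  take-++ʳ : ∀ (xs : List A) {ys} n → take (length xs + n) (xs ++ ys) ≡ xs ++ take n ys
  take-++ʳ []       n = refl
  take-++ʳ (x ∷ xs) n = cong (x ∷_) (take-++ʳ xs n)

  take-applyUpTo : ∀ (f : ℕ → A) {n k} → n ≤ k → take n (applyUpTo f k) ≡ applyUpTo f n
  take-applyUpTo f {zero}  _         = refl
  take-applyUpTo f {suc n} (s≤s n≤k) = cong (f 0 ∷_) (take-applyUpTo (λ i → f (suc i)) n≤k)

nth : List ℕ → ℕ → ℕ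
nth []       _       = 0
nth (x ∷ _)  zero    = x
nth (_ ∷ xs) (suc t) = nth xs t

nth-∈ : ∀ xs {t} → t < length xs → nth xs t ∈ xs
nth-∈ (x ∷ xs) {zero}  _         = here refl
nth-∈ (x ∷ xs) {suc t} (s≤s t<n) = there (nth-∈ xs t<n)

nth-++ˡ : ∀ xs {ys t} → t < length xs → nth (xs ++ ys) t ≡ nth xs t
nth-++ˡ (x ∷ xs) {t = zero}  _         = refl
nth-++ˡ (x ∷ xs) {t = suc t} (s≤s t<n) = nth-++ˡ xs t<n

take-suc-nth : ∀ xs {t} → t < length xs → take (suc t) xs ≡ take t xs ∷ʳ nth xs t
take-suc-nth (x ∷ xs) {zero}  _         = refl
take-suc-nth (x ∷ xs) {suc t} (s≤s t<n) = cong (x ∷_) (take-suc-nth xs t<n)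

prefix-suc : ∀ w n → prefix w (suc n) ≡ prefix w n ∷ʳ w n
prefix-suc w n = begin
  map w (upTo (suc n))   ≡⟨ map-upTo w (suc n) ⟩
  applyUpTo w (suc n)    ≡⟨ applyUpTo-∷ʳ w n ⟨
  applyUpTo w n ∷ʳ w n   ≡⟨ cong (_∷ʳ w n) (map-upTo w n) ⟨
  map w (upTo n) ∷ʳ w n  ∎

∈-prefix⁻ : ∀ w {n x} → x ∈ prefix w n → ∃ λ t → t < n × w t ≡ x
∈-prefix⁻ w {n} x∈ with ∈-applyUpTo⁻ w (subst (_ ∈_) (map-upTo w n) x∈)
... | t , t<n , refl = t , t<n , refl

∈-prefix⇒InSeen : ∀ w {n t x} → x ∈ prefix w n → n ≤ suc t → InSeen w t x
∈-prefix⇒InSeen w x∈ n≤1+t with ∈-prefix⁻ w x∈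
... | s , s<n , ws≡x = s , ≤-pred (≤-trans s<n n≤1+t) , ws≡x

split-at : ∀ {P : ℕ → Set} r → (∀ {t} → t < r → P t) → (∀ d → P (r + d)) → ∀ t → P t
split-at r below above t with t <? r
... | yes t<r = below t<r
... | no  t≮r with m≤n⇒∃[o]m+o≡n (≮⇒≥ t≮r)
...   | d , refl = above d

count-none : ∀ (P : ℕ → Set) m k → (∀ {i} → i < k → ¬ P (m + i)) → Count P m k 0
count-none P m zero    _    = cnt-nil
count-none P m (suc k) none =
  cnt-no (subst (λ x → ¬ P x) (+-identityʳ m) (none (s≤s z≤n)))
         (count-none P (suc m) k (λ {i} i<k → subst (λ x → ¬ P x) (+-suc m i) (none (s≤s i<k))))

strict-bound : ∀ (f : ℕ → ℕ) n → ∃ λ b → ∀ {t} → t < n → f t < b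
strict-bound f zero    = 0 , λ ()
strict-bound f (suc n) with strict-bound f n
... | b , below = b + suc (f n) , below′
  where
  below′ : ∀ {t} → t < suc n → f t < b + suc (f n)
  below′ t<1+n with m<1+n⇒m<n∨m≡n t<1+n
  ... | inj₁ t<n  = <-≤-trans (below t<n) (m≤m+n b _)
  ... | inj₂ refl = m≤n+m (suc (f n)) b

tri : ℕ → ℕ
tri zero    = zero
tri (suc m) = tri m + suc m

n≤tri : ∀ n → n ≤ tri n
n≤tri zero    = z≤n
n≤tri (suc n) = m≤n+m (suc n) (tri n)

-- decode x = (m , i) when x = tri m + i with i ≤ m.
nextCell : ℕ × ℕ → ℕ × ℕ
nextCell (m , i) with i ≟ m
... | yes _ = suc m , 0
... | no  _ = m , suc i

decode : ℕ → ℕ × ℕ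
decode zero    = 0 , 0
decode (suc x) = nextCell (decode x)

level : ℕ → ℕ
level x = proj₂ (decode x)

nextCell-last : ∀ m → nextCell (m , m) ≡ (suc m , 0)
nextCell-last m with m ≟ m
... | yes _  = refl
... | no m≢m = contradiction refl m≢m

nextCell-inner : ∀ {m i} → i < m → nextCell (m , i) ≡ (m , suc i)
nextCell-inner {m} {i} i<m with i ≟ m
... | yes i≡m = contradiction i≡m (<⇒≢ i<m)
... | no  _   = refl

decode-tri : ∀ m i → i ≤ m → decode (tri m + i) ≡ (m , i)
decode-tri zero    zero    _   = refl
decode-tri (suc m) zero    _   = begin
  decode (tri (suc m) + 0)       ≡⟨ cong decode (trans (+-identityʳ _) (+-suc (tri m) m)) ⟩
  nextCell (decode (tri m + m))  ≡⟨ cong nextCell (decode-tri m m ≤-refl) ⟩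
  nextCell (m , m)               ≡⟨ nextCell-last m ⟩
  (suc m , 0)                    ∎
decode-tri m       (suc i) i<m = begin
  decode (tri m + suc i)         ≡⟨ cong decode (+-suc (tri m) i) ⟩
  nextCell (decode (tri m + i))  ≡⟨ cong nextCell (decode-tri m i (<⇒≤ i<m)) ⟩
  nextCell (m , i)               ≡⟨ nextCell-inner i<m ⟩
  (m , suc i)                    ∎

level-tri : ∀ {m i} → i ≤ m → level (tri m + i) ≡ i
level-tri {m} {i} i≤m = cong proj₂ (decode-tri m i i≤m)

segment : ℕ → ℕ → List ℕ
segment m d = applyUpTo (tri m +_) (suc d)

take-segment : ∀ m {d j} → d ≤ j → take (suc d) (segment m j) ≡ segment m d
take-segment m d≤j = take-applyUpTo (tri m +_) (s≤s d≤j)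

∈-segment : ∀ m {i d} → i ≤ d → tri m + i ∈ segment m d
∈-segment m i≤d = ∈-applyUpTo⁺ (tri m +_) (s≤s i≤d)

segment-low : ∀ {m j} → j ≤ m → All (λ x → level x ≤ j) (segment m j)
segment-low {m} {j} j≤m = applyUpTo⁺₁ (tri m +_) (suc j) λ i<1+j →
  ≤-trans (≤-reflexive (level-tri (≤-trans (≤-pred i<1+j) j≤m))) (≤-pred i<1+j)

pair : ℕ → ℕ → ℕ
pair a b = tri (a + b) + b

unpair : ℕ → ℕ × ℕ
unpair x = proj₁ (decode x) ∸ proj₂ (decode x) , proj₂ (decode x)

unpair-pair : ∀ a b → unpair (pair a b) ≡ (a , b)
unpair-pair a b rewrite decode-tri (a + b) b (m≤n+m b a) = cong (_, b) (m+n∸n≡m a b)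

decodeList : ℕ → ℕ → List ℕ
decodeList zero    _ = []
decodeList (suc n) c = proj₁ (unpair c) ∷ decodeList n (proj₂ (unpair c))

encodeList : List ℕ → ℕ
encodeList []       = 0
encodeList (x ∷ xs) = pair x (encodeList xs)

decodeList-encodeList : ∀ xs → decodeList (length xs) (encodeList xs) ≡ xs
decodeList-encodeList []       = refl
decodeList-encodeList (x ∷ xs) =
  trans (cong (λ p → proj₁ p ∷ decodeList (length xs) (proj₂ p)) (unpair-pair x (encodeList xs)))
        (cong (x ∷_) (decodeList-encodeList xs))

listAt : ℕ → List ℕ
listAt k = decodeList (proj₁ (unpair k)) (proj₂ (unpair k))

indexOf : List ℕ → ℕ
indexOf xs = pair (length xs) (encodeList xs)

listAt-indexOf : ∀ xs → listAt (indexOf xs) ≡ xs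
listAt-indexOf xs =
  trans (cong (λ p → decodeList (proj₁ p) (proj₂ p)) (unpair-pair (length xs) (encodeList xs)))
        (decodeList-encodeList xs)

language : List ℕ → Lang
language []      _ = ⊤
language (j ∷ Q) x = x ∈ Q ⊎ level x ≤ j

collection : Collection
collection k = language (listAt k)

toCollection : ∀ l {x} → language l x → collection (indexOf l) x
toCollection l = subst (λ l′ → language l′ _) (sym (listAt-indexOf l))

fromCollection : ∀ l {x} → collection (indexOf l) x → language l x
fromCollection l = subst (λ l′ → language l′ _) (listAt-indexOf l)

collection-infinite : ∀ k → Infinite (collection k)
collection-infinite k n = tri n + 0 , ≤-trans (n≤tri n) (m≤m+n (tri n) 0) , bottom (listAt k)
  where
  bottom : ∀ l → language l (tri n + 0)
  bottom []      = tt
  bottom (j ∷ Q) = inj₂ (≤-trans (≤-reflexive (level-tri {n} z≤n)) z≤n)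

module Limit (Q : List ℕ) (ext : ℕ → List ℕ → List ℕ)
             (ext-nonempty : ∀ s R → 0 < length (ext s R)) where

  grown : ℕ → List ℕ
  grown zero    = []
  grown (suc s) = grown s ++ ext s (Q ++ grown s)

  chain : ℕ → List ℕ
  chain s = Q ++ grown s

  chain-suc : ∀ s → chain (suc s) ≡ chain s ++ ext s (chain s)
  chain-suc s = sym (++-assoc Q (grown s) _)

  length-chain-suc : ∀ s → length (chain (suc s)) ≡ length (chain s) + length (ext s (chain s))
  length-chain-suc s = trans (cong length (chain-suc s)) (length-++ (chain s))

  s≤length-chain : ∀ s → s ≤ length (chain s)
  s≤length-chain zero    = z≤n
  s≤length-chain (suc s) = ≤-<-trans (s≤length-chain s)
    (subst (length (chain s) <_) (sym (length-chain-suc s)) (m<m+n _ (ext-nonempty s (chain s))))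

  chain-extends : ∀ {s s′} → s ≤′ s′ → ∃ λ Y → chain s′ ≡ chain s ++ Y
  chain-extends ≤′-refl = [] , sym (++-identityʳ _)
  chain-extends {s} (≤′-step {s′} s≤′s′) with chain-extends s≤′s′
  ... | Y , eq = Y ++ ext s′ (chain s′) , (begin
    chain (suc s′)                      ≡⟨ chain-suc s′ ⟩
    chain s′ ++ ext s′ (chain s′)       ≡⟨ cong (_++ ext s′ (chain s′)) eq ⟩
    (chain s ++ Y) ++ ext s′ (chain s′) ≡⟨ ++-assoc (chain s) Y _ ⟩
    chain s ++ (Y ++ ext s′ (chain s′)) ∎)

  nth-chain : ∀ {s s′ t} → s ≤ s′ → t < length (chain s) → nth (chain s′) t ≡ nth (chain s) t
  nth-chain {s} {t = t} s≤s′ t< with chain-extends (≤⇒≤′ s≤s′)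
  ... | Y , eq = trans (cong (λ l → nth l t) eq) (nth-++ˡ (chain s) t<)

  limit : ℕ → ℕ
  limit t = nth (chain (suc t)) t

  limit-nth : ∀ s {t} → t < length (chain s) → limit t ≡ nth (chain s) t
  limit-nth s {t} t< with ≤-total s (suc t)
  ... | inj₁ s≤1+t = nth-chain s≤1+t t<
  ... | inj₂ 1+t≤s = sym (nth-chain 1+t≤s (s≤length-chain (suc t)))

  prefix-limit : ∀ s {n} → n ≤ length (chain s) → prefix limit n ≡ take n (chain s)
  prefix-limit s {zero}  _  = refl
  prefix-limit s {suc n} n< = begin
    prefix limit (suc n)                ≡⟨ prefix-suc limit n ⟩
    prefix limit n ∷ʳ limit n           ≡⟨ cong₂ _∷ʳ_ (prefix-limit s (<⇒≤ n<)) (limit-nth s n<) ⟩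
    take n (chain s) ∷ʳ nth (chain s) n ≡⟨ take-suc-nth (chain s) n< ⟨
    take (suc n) (chain s)              ∎

  limit-∈-chain : ∀ t → limit t ∈ chain (suc t)
  limit-∈-chain t = nth-∈ (chain (suc t)) (s≤length-chain (suc t))

  enumerated : ∀ s {x} → x ∈ chain s → ∃ λ t → limit t ≡ x
  enumerated s x∈ with ∈-prefix⁻ limit (subst (_ ∈_) whole x∈)
    where
    whole : chain s ≡ prefix limit (length (chain s))
    whole = sym (trans (prefix-limit s ≤-refl) (take-all _ (chain s) ≤-refl))
  ... | t , _ , limit-t≡x = t , limit-t≡x

  grown-all : ∀ {P : ℕ → Set} → (∀ s R → All P (ext s R)) → ∀ s → All P (grown s)
  grown-all ext-P zero    = []
  grown-all ext-P (suc s) = ++⁺ (grown-all ext-P s) (ext-P s _)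

module _ (A : Algorithm) where

  QuietBelow : List ℕ → ℕ → Set
  QuietBelow R b = ∀ {t} → t < length R → A (take (suc t) R) < b

  Shielded : List ℕ → ℕ → ℕ → Set
  Shielded R m j = ∀ {d i} → d < j → d < i → i ≤ m → A (R ++ segment m d) ≢ tri m + i

  record Trap (D j : ℕ) (Q : List ℕ) : Set where
    field
      lead     : List ℕ
      window   : ℕ
      D≤window : D ≤ window
      lead-low : All (λ x → level x ≤ j) lead
      quiet    : QuietBelow (Q ++ lead) (tri window)
      shielded : Shielded (Q ++ lead) window j

    block : List ℕ
    block = lead ++ segment window j

    block-low : j ≤ D → All (λ x → level x ≤ j) block
    block-low j≤D = ++⁺ lead-low (segment-low (≤-trans j≤D D≤window))

  trap₀ : ∀ D Q → Trap D 0 Q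
  trap₀ D Q with strict-bound (λ t → A (take (suc t) Q)) (length Q)
  ... | b , below = record
    { lead     = []
    ; window   = D + b
    ; D≤window = m≤m+n D b
    ; lead-low = []
    ; quiet    = subst (λ R → QuietBelow R (tri (D + b))) (sym (++-identityʳ Q))
                   λ t< → <-≤-trans (below t<) (≤-trans (m≤n+m b D) (n≤tri (D + b)))
    ; shielded = λ ()
    }

  module Stages (Q : List ℕ) (fill : ℕ → List ℕ) (D lvl : ℕ → ℕ)
                (trapAfter : ∀ s R → Trap (D s) (lvl s) R) where

    ext : ℕ → List ℕ → List ℕ
    ext s R = fill s ++ Trap.block (trapAfter s (R ++ fill s))

    ext-nonempty : ∀ s R → 0 < length (ext s R)
    ext-nonempty s R = ≤-trans (s≤s z≤n)
      (≤-trans (length-≤-++ʳ (Trap.lead T)) (length-≤-++ʳ (fill s)))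
      where T = trapAfter s (R ++ fill s)

    open Limit Q ext ext-nonempty public

    stageTrap : ∀ s → Trap (D s) (lvl s) (chain s ++ fill s)
    stageTrap s = trapAfter s (chain s ++ fill s)

    stageWindow : ℕ → ℕ
    stageWindow s = Trap.window (stageTrap s)

    before : ℕ → List ℕ
    before s = (chain s ++ fill s) ++ Trap.lead (stageTrap s)

    chain-suc-before : ∀ s → chain (suc s) ≡ before s ++ segment (stageWindow s) (lvl s)
    chain-suc-before s = begin
      chain (suc s)                                       ≡⟨ chain-suc s ⟩
      chain s ++ (fill s ++ (lead ++ seg))                ≡⟨ ++-assoc (chain s) (fill s) _ ⟨
      (chain s ++ fill s) ++ (lead ++ seg)                ≡⟨ ++-assoc (chain s ++ fill s) lead seg ⟨
      before s ++ seg                                     ∎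
      where
      lead = Trap.lead (stageTrap s)
      seg  = segment (stageWindow s) (lvl s)

    length-chain-suc-before : ∀ s → length (chain (suc s)) ≡ length (before s) + suc (lvl s)
    length-chain-suc-before s = begin
      length (chain (suc s))                                     ≡⟨ cong length (chain-suc-before s) ⟩
      length (before s ++ segment (stageWindow s) (lvl s))       ≡⟨ length-++ (before s) ⟩
      length (before s) + length (segment (stageWindow s) (lvl s))
        ≡⟨ cong (length (before s) +_) (length-applyUpTo (tri (stageWindow s) +_) (suc (lvl s))) ⟩
      length (before s) + suc (lvl s)                            ∎

    s≤length-before : ∀ s → s ≤ length (before s)
    s≤length-before s = ≤-trans (s≤length-chain s)
      (≤-trans (length-≤-++ˡ (chain s)) (length-≤-++ˡ (chain s ++ fill s)))

    Q⊆before : ∀ s {x} → x ∈ Q → x ∈ before s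
    Q⊆before s x∈Q = ∈-++⁺ˡ (∈-++⁺ˡ (∈-++⁺ˡ x∈Q))

    fill⊆chain : ∀ s {x} → x ∈ fill s → x ∈ chain (suc s)
    fill⊆chain s x∈ = ∈-++⁺ʳ Q (∈-++⁺ʳ (grown s) (∈-++⁺ˡ x∈))

    prefix-before : ∀ s {t} → t < length (before s) → prefix limit (suc t) ≡ take (suc t) (before s)
    prefix-before s {t} t< = begin
      prefix limit (suc t)                                       ≡⟨ prefix-limit (suc s) t<chain ⟩
      take (suc t) (chain (suc s))                               ≡⟨ cong (take (suc t)) (chain-suc-before s) ⟩
      take (suc t) (before s ++ segment (stageWindow s) (lvl s)) ≡⟨ take-++ˡ (before s) t< ⟩
      take (suc t) (before s)                                    ∎
      where
      t<chain : suc t ≤ length (chain (suc s))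
      t<chain = subst (suc t ≤_) (sym (length-chain-suc-before s)) (≤-trans t< (m≤m+n _ _))

    prefix-segment : ∀ s {d} → d ≤ lvl s →
                     prefix limit (suc (length (before s) + d)) ≡ before s ++ segment (stageWindow s) d
    prefix-segment s {d} d≤ = begin
      prefix limit (suc (r + d))              ≡⟨ prefix-limit (suc s) r+d<chain ⟩
      take (suc (r + d)) (chain (suc s))      ≡⟨ cong (take (suc (r + d))) (chain-suc-before s) ⟩
      take (suc (r + d)) (before s ++ seg)    ≡⟨ cong (λ n → take n (before s ++ seg)) (+-suc r d) ⟨
      take (r + suc d) (before s ++ seg)      ≡⟨ take-++ʳ (before s) (suc d) ⟩
      before s ++ take (suc d) seg            ≡⟨ cong (before s ++_) (take-segment (stageWindow s) d≤) ⟩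
      before s ++ segment (stageWindow s) d   ∎
      where
      r   = length (before s)
      seg = segment (stageWindow s) (lvl s)
      r+d<chain : suc (r + d) ≤ length (chain (suc s))
      r+d<chain = subst₂ _≤_ (+-suc r d) (sym (length-chain-suc-before s)) (+-monoʳ-≤ r (s≤s d≤))

  module _ (gen : GeneratesInLimit collection A) where

    module TrapStep (D j : ℕ) (j≤D : j ≤ D) (inner : ∀ R → Trap D j R) (Q : List ℕ) where

      fill : ℕ → List ℕ
      fill s = filter (λ x → level x ≤? j) (s ∷ [])

      open Stages Q fill (λ _ → D) (λ _ → j) (λ _ → inner)

      fill-low : ∀ s → All (λ x → level x ≤ j) (fill s)
      fill-low s = all-filter (λ x → level x ≤? j) (s ∷ [])

      grown-low : ∀ s → All (λ x → level x ≤ j) (grown s)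
      grown-low = grown-all λ s R → ++⁺ (fill-low s) (Trap.block-low (inner (R ++ fill s)) j≤D)

      limit-in-language : ∀ t → language (j ∷ Q) (limit t)
      limit-in-language t with ∈-++⁻ Q (limit-∈-chain t)
      ... | inj₁ ∈Q     = inj₁ ∈Q
      ... | inj₂ ∈grown = inj₂ (All.lookup (grown-low (suc t)) ∈grown)

      language-enumerated : ∀ {x} → language (j ∷ Q) x → ∃ λ t → limit t ≡ x
      language-enumerated (inj₁ x∈Q) = enumerated 0 (∈-++⁺ˡ x∈Q)
      language-enumerated {x} (inj₂ low) =
        enumerated (suc x) (fill⊆chain x (∈-filter⁺ (λ x → level x ≤? j) (here refl) low))

      enumerates : IsEnumeration (collection (indexOf (j ∷ Q))) limit
      enumerates = (λ t → toCollection (j ∷ Q) (limit-in-language t))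
                 , (λ x x∈ → language-enumerated (fromCollection (j ∷ Q) x∈))

      t* : ℕ
      t* = proj₁ (gen (indexOf (j ∷ Q)) limit enumerates)

      T : Trap D j (chain t* ++ fill t*)
      T = stageTrap t*

      m : ℕ
      m = Trap.window T

      τ : ℕ
      τ = length (before t*) + j

      settled : ∀ t → t* ≤ t →
                collection (indexOf (j ∷ Q)) (output A limit t) × ¬ InSeen limit t (output A limit t)
      settled = proj₂ (gen (indexOf (j ∷ Q)) limit enumerates)

      t*≤τ : t* ≤ τ
      t*≤τ = ≤-trans (s≤length-before t*) (m≤m+n _ j)

      -- At time τ window m has been revealed up to level j; a correct guess is unseen, so not in Q,
      -- and lies in the target Q ∪ {level ≤ j}, so not higher up in window m.
      unseen-guess-outside : ∀ {o i} → j < i → i ≤ m →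
                             language (j ∷ Q) o → ¬ InSeen limit τ o → o ≢ tri m + i
      unseen-guess-outside _   _   (inj₁ o∈Q) unseen _ = unseen (∈-prefix⇒InSeen limit
        (subst (_ ∈_) (sym (prefix-segment t* ≤-refl)) (∈-++⁺ˡ (Q⊆before t* o∈Q))) ≤-refl)
      unseen-guess-outside j<i i≤m (inj₂ low) _ refl = <⇒≱ j<i (subst (_≤ j) (level-tri i≤m) low)

      guesses-outside : ∀ {i} → j < i → i ≤ m → A (before t* ++ segment m j) ≢ tri m + i
      guesses-outside j<i i≤m guess =
        unseen-guess-outside j<i i≤m (fromCollection (j ∷ Q) (proj₁ (settled τ t*≤τ)))
          (proj₂ (settled τ t*≤τ)) (trans (cong A (prefix-segment t* ≤-refl)) guess)

      lead : List ℕ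
      lead = grown t* ++ (fill t* ++ Trap.lead T)

      Q++lead : Q ++ lead ≡ before t*
      Q++lead = sym (trans (++-assoc (chain t*) (fill t*) (Trap.lead T))
                           (++-assoc Q (grown t*) (fill t* ++ Trap.lead T)))

      shielded-before : ∀ {d i} → d < suc j → d < i → i ≤ m → A (before t* ++ segment m d) ≢ tri m + i
      shielded-before {d} {i} d<1+j d<i i≤m =
        [ (λ d<j → Trap.shielded T d<j d<i i≤m)
        , (λ d≡j → subst (λ d → A (before t* ++ segment m d) ≢ tri m + i) (sym d≡j)
                     (guesses-outside (subst (_< i) d≡j d<i) i≤m))
        ]′ (m<1+n⇒m<n∨m≡n d<1+j)

      trap-suc : Trap D (suc j) Q
      trap-suc = record
        { lead     = lead
        ; window   = m
        ; D≤window = Trap.D≤window T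
        ; lead-low = All.map m≤n⇒m≤1+n
                       (++⁺ (grown-low t*) (++⁺ (fill-low t*) (Trap.lead-low T)))
        ; quiet    = subst (λ R → QuietBelow R (tri m)) (sym Q++lead) (Trap.quiet T)
        ; shielded = λ {d} {i} d<1+j d<i i≤m → subst (λ R → A (R ++ segment m d) ≢ tri m + i)
                                                      (sym Q++lead) (shielded-before d<1+j d<i i≤m)
        }

    trap : ∀ D j → j ≤ D → ∀ Q → Trap D j Q
    trap D zero    _     = trap₀ D
    trap D (suc j) 1+j≤D = TrapStep.trap-suc D j (<⇒≤ 1+j≤D) (trap D j (<⇒≤ 1+j≤D))

    module Adversary where

      open Stages [] (λ s → s ∷ []) (λ s → s) (λ s → s) (λ s → trap s s ≤-refl)

      -- Index 0 decodes to the empty list, so collection 0 is ℕ.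
      enumerates : IsEnumeration (collection 0) limit
      enumerates = (λ _ → tt) , (λ x _ → enumerated (suc x) (fill⊆chain x (here refl)))

      t₀ : ℕ
      t₀ = proj₁ (gen 0 limit enumerates)

      unseen : ∀ t → t₀ ≤ t → ¬ InSeen limit t (output A limit t)
      unseen t t₀≤t = proj₂ (proj₂ (gen 0 limit enumerates) t t₀≤t)

      module _ (n : ℕ) (t₀<n : t₀ < n) where

        r : ℕ
        r = length (before n)

        m : ℕ
        m = stageWindow n

        T : Trap n n (chain n ++ (n ∷ []))
        T = stageTrap n

        quiet-early : ∀ {i t} → t < r → output A limit t ≢ tri m + i
        quiet-early {i} {t} t<r guess = <⇒≱ (subst (_< tri m) early (Trap.quiet T t<r)) (m≤m+n (tri m) i)
          where
          early : A (take (suc t) (before n)) ≡ tri m + i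
          early = trans (cong A (sym (prefix-before n t<r))) guess

        shielded-late : ∀ {i d} → i ≤ n → d < i → output A limit (r + d) ≢ tri m + i
        shielded-late i≤n d<i guess = Trap.shielded T (<-≤-trans d<i i≤n) d<i (≤-trans i≤n (Trap.D≤window T))
          (trans (cong A (sym (prefix-segment n (≤-trans (<⇒≤ d<i) i≤n)))) guess)

        seen-late : ∀ {i} → i ≤ n → ∀ e → output A limit (r + (i + e)) ≢ tri m + i
        seen-late {i} i≤n e guess = unseen (r + (i + e)) t₀≤ (subst (InSeen limit _) (sym guess) seen)
          where
          t₀≤ : t₀ ≤ r + (i + e)
          t₀≤ = ≤-trans (<⇒≤ t₀<n) (≤-trans (s≤length-before n) (m≤m+n r _))
          seen : InSeen limit (r + (i + e)) (tri m + i)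
          seen = ∈-prefix⇒InSeen limit
                   (subst (tri m + i ∈_) (sym (prefix-segment n i≤n)) (∈-++⁺ʳ (before n) (∈-segment m ≤-refl)))
                   (s≤s (+-monoʳ-≤ r (m≤m+n i e)))

        segment-unguessed : ∀ {i} → i ≤ n → ¬ InOutput A limit (tri m + i)
        segment-unguessed {i} i≤n (t , guess) =
          split-at {λ t → output A limit t ≢ tri m + i} r quiet-early
            (split-at i (shielded-late i≤n) (seen-late i≤n)) t guess

      density : DensityZeroAlong (InOutput A limit) (λ i → i)
      density _ N = suc n , ≤-trans (m≤m+n N (suc t₀)) (n≤1+n n) , tri (stageWindow n) , 0
                  , count-none _ _ (suc n) (λ i<1+n → segment-unguessed n t₀<n (≤-pred i<1+n)) , s≤s z≤n
        where
        n = N + suc t₀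
        t₀<n = m≤n+m (suc t₀) N

      result : ∃ λ i → ∃ λ w → IsEnumeration (collection i) w ×
                 LowerBanachDensityZero (InOutput A w) (collection i)
      result = 0 , limit , enumerates
             , (λ i → i) , ((λ i → n<1+n i) , (λ _ → tt) , (λ x _ → x , refl)) , density

theorem1p1 : ∃ λ (X : Collection) → (∀ i → Infinite (X i)) ×
               (∀ (A : Algorithm) → GeneratesInLimit X A →
                 ∃ λ i → ∃ λ w → IsEnumeration (X i) w ×
                   LowerBanachDensityZero (InOutput A w) (X i))
theorem1p1 = collection , collection-infinite , Adversary.result
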